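{- For any odd prime $p$, $$\begin{bmatrix}2p+2\\ p\end{bmatrix}_q\equiv 1+q^p\pmod{[p]_{q^2}}$$ in the polynomial ring $\mathbb{Z}[q]$.
   Context: For integers $n$ and $m\ge 0$, the $q$-binomial coefficient is $\begin{bmatrix}n\\ m\end{bmatrix}_q=\frac{(1-q^n)(1-q^{n-1})\cdots(1-q^{n-m+1})}{(1-q^m)(1-q^{m-1})\cdots(1-q)}$, a polynomial in $q$ with integer coefficients. For a non-negative integer $n$, $[n]_q=\frac{1-q^n}{1-q}$, so $[p]_{q^2}=\frac{1-q^{2p}}{1-q^2}=1+q^2+\cdots+q^{2(p-1)}$. A congruence $f\equiv g\pmod{h}$ of polynomials means $h$ divides $f-g$ in $\mathbb{Z}[q]$. -}

module Defs where

open import Data.Nat using (ℕ; zero; suc; _∸_)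
open import Data.Integer using (ℤ; +_; _+_; _*_; -_)
open import Data.List using (List; []; _∷_; replicate; _++_; [_]; foldr; map; upTo)
open import Data.Product using (∃)
open import Relation.Binary.PropositionalEquality using (_≡_)

-- Polynomials in ℤ[q], represented by coefficient lists (lowest degree first).
-- Trailing zeros are allowed; equality is coefficientwise (_≈P_).
Poly : Set
Poly = List ℤ

coeff : Poly → ℕ → ℤ
coeff []       _       = + 0
coeff (a ∷ f)  zero    = a
coeff (a ∷ f)  (suc i) = coeff f i

infix 4 _≈P_
_≈P_ : Poly → Poly → Set
f ≈P g = ∀ i → coeff f i ≡ coeff g i

infixl 6 _+P_ _-P_
infixl 7 _*P_

_+P_ : Poly → Poly → Poly
[]      +P g       = g
(a ∷ f) +P []      = a ∷ f
(a ∷ f) +P (b ∷ g) = (a + b) ∷ (f +P g)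

-P_ : Poly → Poly
-P f = map -_ f

_-P_ : Poly → Poly → Poly
f -P g = f +P (-P g)

scaleP : ℤ → Poly → Poly
scaleP a g = map (a *_) g

_*P_ : Poly → Poly → Poly
[]      *P g = []
(a ∷ f) *P g = scaleP a g +P (+ 0 ∷ (f *P g))

oneP : Poly
oneP = [ + 1 ]

qPow : ℕ → Poly
qPow k = replicate k (+ 0) ++ [ + 1 ]

prodP : List Poly → Poly
prodP = foldr _*P_ oneP

sumP : List Poly → Poly
sumP = foldr _+P_ []

-- numerator (1-q^n)(1-q^{n-1})...(1-q^{n-m+1})   (for n ≥ m, as used here)
qBinomNum : ℕ → ℕ → Poly
qBinomNum n m = prodP (map (λ i → oneP -P qPow (n ∸ i)) (upTo m))

qBinomDen : ℕ → Poly
qBinomDen m = prodP (map (λ i → oneP -P qPow (suc i)) (upTo m))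

-- B is the q-binomial coefficient [n choose m]_q : B * denominator = numerator in ℤ[q]
-- (ℤ[q] is an integral domain and the denominator is nonzero, so B is unique)
IsQBinom : ℕ → ℕ → Poly → Set
IsQBinom n m B = B *P qBinomDen m ≈P qBinomNum n m

qInt-q² : ℕ → Poly
qInt-q² p = sumP (map (λ j → qPow (2 Data.Nat.* j)) (upTo p))

infix 4 _∣P_
_∣P_ : Poly → Poly → Set
h ∣P f = ∃ λ C → f ≈P C *P h

_≡P_[mod_] : Poly → Poly → Poly → Set
f ≡P g [mod h ] = h ∣P (f -P g)

-- Write f = [p]_{q²}, so that (1 - q²) f = 1 - q^(2p), and let [n, k] be the q-binomial
-- coefficient defined by the q-Pascal rule. For 0 < j < p the factor 1 - q^j cancels modulo f:
-- the exponents e with q^e y ≡ y (mod f) form a group containing j and 2p, hence 2, and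
-- 1 - q² = -(q - 1)(q + 1) cancels because f(±1) = p ≠ 0. Clearing the denominator
-- (1 - q)⋯(1 - q^k) therefore gives [2p, k] ≡ 0 for 0 < k < p, the numerator containing
-- 1 - q^(2p); and [2p, p] ≡ 1 + q^p, since after cancelling 1 - q^p the numerator is
-- (1 + q^p) ∏ (1 - q^(p+i)) and (1 + q^p) q^p ≡ 1 + q^p. Applying Pascal's rule twice,
-- [2p+2, p] = [2p, p-2] + (q^(p-1) + q^p) [2p, p-1] + q^(2p) [2p, p] ≡ q^(2p) (1 + q^p) ≡ 1 + q^p,
-- where p ≥ 3 makes p - 2 positive.
module Submission where

open import Defs
open import Level using (0ℓ)
open import Function using (_∘_)
open import Data.Product using (∃; _,_; _×_)
open import Data.Sum using (inj₁; inj₂)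
import Data.Maybe as Maybe
open Maybe using (Maybe; just; nothing)
open import Data.List using (List; []; _∷_; [_]; _∷ʳ_; map; foldr; upTo; length)
import Data.List.Properties as LP
open import Data.Nat using (ℕ; zero; suc; _+_; _*_; _∸_; _<_; _≤_; s≤s; z≤n; nonTrivial⇒n>1)
import Data.Nat.Properties as NP
import Data.Nat.Tactic.RingSolver as ℕ-Solver
open import Data.Nat.GCD using (module Bézout)
open import Data.Nat.Coprimality using (coprime-Bézout; prime⇒coprime)
open import Data.Nat.Primality using (Prime; prime⇒nonTrivial)
open import Data.Integer using (ℤ; +_; -_) renaming (_+_ to _+ℤ_; _*_ to _*ℤ_)
import Data.Integer.Properties as ℤ
import Data.Integer.Tactic.RingSolver as ℤ-Solver
import Algebra.Properties.CommutativeSemigroup ℤ.+-commutativeSemigroup as ℤ+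
open import Algebra.Bundles using (Monoid; Ring; CommutativeRing)
import Tactic.RingSolver.Core.AlmostCommutativeRing as ACR
open import Tactic.RingSolver using (solve-∀)
open import Relation.Nullary using (contradiction)
open import Relation.Binary.PropositionalEquality
  using (_≡_; _≢_; refl; sym; trans; cong; cong₂; subst; ≢-sym; module ≡-Reasoning)
import Relation.Binary.Reasoning.Setoid

-- The ring ℤ[q]

coeff-+ : ∀ f g i → coeff (f +P g) i ≡ coeff f i +ℤ coeff g i
coeff-+ []      g       i       = sym (ℤ.+-identityˡ _)
coeff-+ (a ∷ f) []      i       = sym (ℤ.+-identityʳ _)
coeff-+ (a ∷ f) (b ∷ g) zero    = refl
coeff-+ (a ∷ f) (b ∷ g) (suc i) = coeff-+ f g i

coeff-map : ∀ {φ : ℤ → ℤ} → φ (+ 0) ≡ + 0 → ∀ f i → coeff (map φ f) i ≡ φ (coeff f i)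
coeff-map φ0≡0 []      i       = sym φ0≡0
coeff-map φ0≡0 (a ∷ f) zero    = refl
coeff-map φ0≡0 (a ∷ f) (suc i) = coeff-map φ0≡0 f i

coeff-neg : ∀ f i → coeff (-P f) i ≡ - coeff f i
coeff-neg = coeff-map refl

coeff-scale : ∀ a f i → coeff (scaleP a f) i ≡ a *ℤ coeff f i
coeff-scale a = coeff-map (ℤ.*-zeroʳ a)

-- A record rather than the function type f ≈P g, so that f and g can be
-- inferred from a proof of f ≈ g.
infix 4 _≈_
record _≈_ (f g : Poly) : Set where
  constructor coeffwise
  field coeff-≡ : f ≈P g
open _≈_ public

≈-refl : ∀ {f} → f ≈ f
≈-refl = coeffwise λ _ → refl

≈-sym : ∀ {f g} → f ≈ g → g ≈ f
≈-sym (coeffwise e) = coeffwise λ i → sym (e i)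

≈-trans : ∀ {f g h} → f ≈ g → g ≈ h → f ≈ h
≈-trans (coeffwise e) (coeffwise e′) = coeffwise λ i → trans (e i) (e′ i)

≈-reflexive : ∀ {f g} → f ≡ g → f ≈ g
≈-reflexive refl = ≈-refl

shift : Poly → Poly
shift f = + 0 ∷ f

∷-cong : ∀ {a b f g} → a ≡ b → f ≈ g → a ∷ f ≈ b ∷ g
∷-cong a≡b (coeffwise e) = coeffwise λ { zero → a≡b ; (suc i) → e i }

∷-injective : ∀ {a b f g} → a ∷ f ≈ b ∷ g → a ≡ b × f ≈ g
∷-injective (coeffwise e) = e zero , coeffwise (e ∘ suc)

∷-≈[]⁻¹ : ∀ {a f} → a ∷ f ≈ [] → a ≡ + 0 × f ≈ []
∷-≈[]⁻¹ (coeffwise e) = e zero , coeffwise (e ∘ suc)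

shift-cong : ∀ {f g} → f ≈ g → shift f ≈ shift g
shift-cong = ∷-cong refl

∷-≈[] : ∀ {a f} → a ≡ + 0 → f ≈ [] → a ∷ f ≈ []
∷-≈[] a≡0 (coeffwise e) = coeffwise λ { zero → a≡0 ; (suc i) → e i }

+-cong : ∀ {f f′ g g′} → f ≈ f′ → g ≈ g′ → f +P g ≈ f′ +P g′
+-cong {f} {f′} {g} {g′} (coeffwise e) (coeffwise e′) = coeffwise λ i → begin
  coeff (f +P g) i          ≡⟨ coeff-+ f g i ⟩
  coeff f i +ℤ coeff g i    ≡⟨ cong₂ _+ℤ_ (e i) (e′ i) ⟩
  coeff f′ i +ℤ coeff g′ i  ≡⟨ coeff-+ f′ g′ i ⟨
  coeff (f′ +P g′) i        ∎
  where open ≡-Reasoning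

-P-cong : ∀ {f g} → f ≈ g → -P f ≈ -P g
-P-cong {f} {g} (coeffwise e) = coeffwise λ i →
  trans (coeff-neg f i) (trans (cong -_ (e i)) (sym (coeff-neg g i)))

+-assoc : ∀ f g h → (f +P g) +P h ≈ f +P (g +P h)
+-assoc f g h = coeffwise pointwise
  where
  pointwise : ∀ i → coeff ((f +P g) +P h) i ≡ coeff (f +P (g +P h)) i
  pointwise i rewrite coeff-+ (f +P g) h i | coeff-+ f g i
                    | coeff-+ f (g +P h) i | coeff-+ g h i = ℤ.+-assoc (coeff f i) (coeff g i) (coeff h i)

+-comm : ∀ f g → f +P g ≈ g +P f
+-comm f g = coeffwise pointwise
  where
  pointwise : ∀ i → coeff (f +P g) i ≡ coeff (g +P f) i
  pointwise i rewrite coeff-+ f g i | coeff-+ g f i = ℤ.+-comm (coeff f i) (coeff g i)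

+-leftComm : ∀ f g h → f +P (g +P h) ≈ g +P (f +P h)
+-leftComm f g h = coeffwise pointwise
  where
  pointwise : ∀ i → coeff (f +P (g +P h)) i ≡ coeff (g +P (f +P h)) i
  pointwise i rewrite coeff-+ f (g +P h) i | coeff-+ g h i
                    | coeff-+ g (f +P h) i | coeff-+ f h i = ℤ+.x∙yz≈y∙xz (coeff f i) (coeff g i) (coeff h i)

+-identityʳ : ∀ f → f +P [] ≈ f
+-identityʳ f = coeffwise λ i → trans (coeff-+ f [] i) (ℤ.+-identityʳ _)

-P-inverseˡ : ∀ f → (-P f) +P f ≈ []
-P-inverseˡ f = coeffwise pointwise
  where
  pointwise : ∀ i → coeff ((-P f) +P f) i ≡ + 0
  pointwise i rewrite coeff-+ (-P f) f i | coeff-neg f i = ℤ.+-inverseˡ (coeff f i)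

-P-inverseʳ : ∀ f → f +P (-P f) ≈ []
-P-inverseʳ f = ≈-trans (+-comm f (-P f)) (-P-inverseˡ f)

+-interchange : ∀ f g h k → (f +P g) +P (h +P k) ≈ (f +P h) +P (g +P k)
+-interchange f g h k = coeffwise pointwise
  where
  pointwise : ∀ i → coeff ((f +P g) +P (h +P k)) i ≡ coeff ((f +P h) +P (g +P k)) i
  pointwise i rewrite coeff-+ (f +P g) (h +P k) i | coeff-+ f g i | coeff-+ h k i
                    | coeff-+ (f +P h) (g +P k) i | coeff-+ f h i | coeff-+ g k i
    = ℤ+.interchange (coeff f i) (coeff g i) (coeff h i) (coeff k i)

scale-congˡ : ∀ a {f g} → f ≈ g → scaleP a f ≈ scaleP a g
scale-congˡ a {f} {g} (coeffwise e) = coeffwise λ i →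
  trans (coeff-scale a f i) (trans (cong (a *ℤ_) (e i)) (sym (coeff-scale a g i)))

scale-congʳ : ∀ {a b} f → a ≡ b → scaleP a f ≈ scaleP b f
scale-congʳ f refl = ≈-refl

scale-distribˡ : ∀ a f g → scaleP a (f +P g) ≈ scaleP a f +P scaleP a g
scale-distribˡ a f g = coeffwise pointwise
  where
  pointwise : ∀ i → coeff (scaleP a (f +P g)) i ≡ coeff (scaleP a f +P scaleP a g) i
  pointwise i rewrite coeff-scale a (f +P g) i | coeff-+ f g i
                    | coeff-+ (scaleP a f) (scaleP a g) i
                    | coeff-scale a f i | coeff-scale a g i = ℤ.*-distribˡ-+ a _ _

scale-distribʳ : ∀ a b f → scaleP (a +ℤ b) f ≈ scaleP a f +P scaleP b f
scale-distribʳ a b f = coeffwise pointwise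
  where
  pointwise : ∀ i → coeff (scaleP (a +ℤ b) f) i ≡ coeff (scaleP a f +P scaleP b f) i
  pointwise i rewrite coeff-scale (a +ℤ b) f i | coeff-+ (scaleP a f) (scaleP b f) i
                    | coeff-scale a f i | coeff-scale b f i = ℤ.*-distribʳ-+ (coeff f i) a b

scale-zero : ∀ f → scaleP (+ 0) f ≈ []
scale-zero f = coeffwise λ i → trans (coeff-scale (+ 0) f i) (ℤ.*-zeroˡ (coeff f i))

scale-one : ∀ f → scaleP (+ 1) f ≈ f
scale-one f = coeffwise λ i → trans (coeff-scale (+ 1) f i) (ℤ.*-identityˡ (coeff f i))

scale-scale : ∀ a b f → scaleP a (scaleP b f) ≈ scaleP (a *ℤ b) f
scale-scale a b f = coeffwise pointwise
  where
  pointwise : ∀ i → coeff (scaleP a (scaleP b f)) i ≡ coeff (scaleP (a *ℤ b) f) i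
  pointwise i rewrite coeff-scale a (scaleP b f) i | coeff-scale b f i
                    | coeff-scale (a *ℤ b) f i = sym (ℤ.*-assoc a b (coeff f i))

*-zeroʳ : ∀ f → f *P [] ≈ []
*-zeroʳ []      = ≈-refl
*-zeroʳ (a ∷ f) = ∷-≈[] refl (*-zeroʳ f)

x≈0⇒x*y≈0 : ∀ {f} g → f ≈ [] → f *P g ≈ []
x≈0⇒x*y≈0 {[]}    g f≈0 = ≈-refl
x≈0⇒x*y≈0 {a ∷ f} g a∷f≈0 with a≡0 , f≈0 ← ∷-≈[]⁻¹ a∷f≈0 =
  ≈-trans (+-cong (≈-trans (scale-congʳ g a≡0) (scale-zero g)) (shift-cong (x≈0⇒x*y≈0 g f≈0)))
          (∷-≈[] refl ≈-refl)

*-congʳ : ∀ {f f′} g → f ≈ f′ → f *P g ≈ f′ *P g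
*-congʳ {[]}    {f′}     g e = ≈-sym (x≈0⇒x*y≈0 g (≈-sym e))
*-congʳ {a ∷ f} {[]}     g e = x≈0⇒x*y≈0 g e
*-congʳ {a ∷ f} {b ∷ f′} g e with a≡b , f≈f′ ← ∷-injective e =
  +-cong (scale-congʳ g a≡b) (shift-cong (*-congʳ g f≈f′))

*-congˡ : ∀ f {g g′} → g ≈ g′ → f *P g ≈ f *P g′
*-congˡ []      e = ≈-refl
*-congˡ (a ∷ f) e = +-cong (scale-congˡ a e) (shift-cong (*-congˡ f e))

*-cong : ∀ {f f′ g g′} → f ≈ f′ → g ≈ g′ → f *P g ≈ f′ *P g′
*-cong {f′ = f′} {g} e e′ = ≈-trans (*-congʳ g e) (*-congˡ f′ e′)

*-distribˡ : ∀ f g h → f *P (g +P h) ≈ f *P g +P f *P h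
*-distribˡ []      g h = ≈-refl
*-distribˡ (a ∷ f) g h =
  ≈-trans (+-cong (scale-distribˡ a g h) (shift-cong (*-distribˡ f g h)))
          (+-interchange (scaleP a g) (scaleP a h) (shift (f *P g)) (shift (f *P h)))

*-distribʳ : ∀ h f g → (f +P g) *P h ≈ f *P h +P g *P h
*-distribʳ h []      g       = ≈-refl
*-distribʳ h (a ∷ f) []      = ≈-sym (+-identityʳ _)
*-distribʳ h (a ∷ f) (b ∷ g) =
  ≈-trans (+-cong (scale-distribʳ a b h) (shift-cong (*-distribʳ h f g)))
          (+-interchange (scaleP a h) (scaleP b h) (shift (f *P h)) (shift (g *P h)))

*-identityˡ : ∀ f → oneP *P f ≈ f
*-identityˡ f = ≈-trans (+-cong (scale-one f) (∷-≈[] refl ≈-refl)) (+-identityʳ f)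

*-consʳ : ∀ f b g → f *P (b ∷ g) ≈ scaleP b f +P shift (f *P g)
*-consʳ []      b g = ≈-sym (∷-≈[] refl ≈-refl)
*-consʳ (c ∷ f) b g =
  ∷-cong (cong (_+ℤ + 0) (ℤ.*-comm c b))
         (≈-trans (+-cong (≈-refl {scaleP c g}) (*-consʳ f b g))
                  (+-leftComm (scaleP c g) (scaleP b f) (shift (f *P g))))

*-comm : ∀ f g → f *P g ≈ g *P f
*-comm []      g = ≈-sym (*-zeroʳ g)
*-comm (a ∷ f) g = ≈-trans (+-cong (≈-refl {scaleP a g}) (shift-cong (*-comm f g))) (≈-sym (*-consʳ g a f))

*-identityʳ : ∀ f → f *P oneP ≈ f
*-identityʳ f = ≈-trans (*-comm f oneP) (*-identityˡ f)

scale-*ˡ : ∀ a g h → scaleP a g *P h ≈ scaleP a (g *P h)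
scale-*ˡ a []      h = ≈-refl
scale-*ˡ a (b ∷ g) h =
  ≈-trans (+-cong (≈-sym (scale-scale a b h)) (∷-cong (sym (ℤ.*-zeroʳ a)) (scale-*ˡ a g h)))
          (≈-sym (scale-distribˡ a (scaleP b h) (shift (g *P h))))

shift-*ˡ : ∀ g h → shift g *P h ≈ shift (g *P h)
shift-*ˡ g h = +-cong (scale-zero h) ≈-refl

*-assoc : ∀ f g h → (f *P g) *P h ≈ f *P (g *P h)
*-assoc []      g h = ≈-refl
*-assoc (a ∷ f) g h =
  ≈-trans (*-distribʳ h (scaleP a g) (shift (f *P g)))
          (+-cong (scale-*ˡ a g h) (≈-trans (shift-*ˡ (f *P g) h) (shift-cong (*-assoc f g h))))

ℤ[q] : CommutativeRing 0ℓ 0ℓ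
ℤ[q] = record
  { Carrier = Poly ; _≈_ = _≈_ ; _+_ = _+P_ ; _*_ = _*P_ ; -_ = -P_ ; 0# = [] ; 1# = oneP
  ; isCommutativeRing = record
    { isRing = record
      { +-isAbelianGroup = record
        { isGroup = record
          { isMonoid = record
            { isSemigroup = record
              { isMagma = record
                { isEquivalence = record { refl = ≈-refl ; sym = ≈-sym ; trans = ≈-trans }
                ; ∙-cong = +-cong }
              ; assoc = +-assoc }
            ; identity = (λ _ → ≈-refl) , +-identityʳ }
          ; inverse = -P-inverseˡ , -P-inverseʳ
          ; ⁻¹-cong = -P-cong }
        ; comm = +-comm }
      ; *-cong = *-cong
      ; *-assoc = *-assoc
      ; *-identity = *-identityˡ , *-identityʳ
      ; distrib = *-distribˡ , *-distribʳ }
    ; *-comm = *-comm } }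

-- Lets the solver discard constant zeros such as 1 - 1.
[]≈? : ∀ f → Maybe ([] ≈ f)
[]≈? []          = just ≈-refl
[]≈? (+ 0 ∷ f)   = Maybe.map (λ e → ≈-sym (∷-≈[] refl (≈-sym e))) ([]≈? f)
[]≈? (_ ∷ _)     = nothing

ℤ[q]-solverRing : ACR.AlmostCommutativeRing 0ℓ 0ℓ
ℤ[q]-solverRing = ACR.fromCommutativeRing ℤ[q] []≈?

module ≈-Reasoning = Relation.Binary.Reasoning.Setoid (CommutativeRing.setoid ℤ[q])

module RingDivisibility {a ℓ} (R : Ring a ℓ) where
  private module R = Ring R
  open import Algebra.Definitions.RawMagma R.*-rawMagma using (_∣_; _,_)
  open import Algebra.Properties.Ring R using (-‿distribˡ-*)

  ∣-+ : ∀ {h x y} → h ∣ x → h ∣ y → h ∣ x R.+ y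
  ∣-+ {h} (a , ah≈x) (b , bh≈y) = a R.+ b , R.trans (R.distribʳ h a b) (R.+-cong ah≈x bh≈y)

  ∣-neg : ∀ {h x} → h ∣ x → h ∣ R.- x
  ∣-neg {h} (a , ah≈x) = R.- a , R.trans (R.sym (-‿distribˡ-* a h)) (R.-‿cong ah≈x)

  ∣-- : ∀ {h x y} → h ∣ x → h ∣ y → h ∣ x R.- y
  ∣-- h∣x h∣y = ∣-+ h∣x (∣-neg h∣y)

open RingDivisibility (CommutativeRing.ring ℤ[q])
open import Algebra.Properties.Semiring.Divisibility (CommutativeRing.semiring ℤ[q])
  using (_∣_; _,_; ∣ʳ-respʳ-≈; x∣ʳy⇒x∣ʳzy; _∣0)

∣-*ʳ : ∀ {h x} y → h ∣ x → h ∣ x *P y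
∣-*ʳ {x = x} y h∣x = ∣ʳ-respʳ-≈ (*-comm y x) (x∣ʳy⇒x∣ʳzy y h∣x)

∣⇒∣P : ∀ {h f} → h ∣ f → h ∣P f
∣⇒∣P (C , C*h≈f) = C , λ i → sym (coeff-≡ C*h≈f i)

infix 8 1-q^_
1-q^_ : ℕ → Poly
1-q^ n = oneP -P qPow n

qPow-+ : ∀ a b → qPow (a + b) ≈ qPow a *P qPow b
qPow-+ zero    b = ≈-sym (*-identityˡ (qPow b))
qPow-+ (suc a) b = ≈-trans (shift-cong (qPow-+ a b)) (≈-sym (shift-*ˡ (qPow a) (qPow b)))

1-q^-+ : ∀ a b → 1-q^ (a + b) ≈ 1-q^ a +P qPow a *P 1-q^ b
1-q^-+ a b = ≈-trans (+-cong (≈-refl {oneP}) (-P-cong (qPow-+ a b))) (identity (qPow a) (qPow b))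
  where
  identity : ∀ x y → oneP -P x *P y ≈ (oneP -P x) +P x *P (oneP -P y)
  identity = solve-∀ ℤ[q]-solverRing

1-q^0≈0 : 1-q^ 0 ≈ []
1-q^0≈0 = ∷-≈[] refl ≈-refl

qPow-2* : ∀ n → qPow (2 * n) ≈ qPow n *P qPow n
qPow-2* n = ≈-trans (≈-reflexive (cong (λ k → qPow (n + k)) (NP.+-identityʳ n))) (qPow-+ n n)

1-q^-2*-square : ∀ n → 1-q^ (2 * n) ≈ oneP -P qPow n *P qPow n
1-q^-2*-square n = +-cong (≈-refl {oneP}) (-P-cong (qPow-2* n))

1-q^-2* : ∀ n → 1-q^ (2 * n) ≈ 1-q^ n *P (oneP +P qPow n)
1-q^-2* n = ≈-trans (1-q^-2*-square n) (identity (qPow n))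
  where
  identity : ∀ x → oneP -P x *P x ≈ (oneP -P x) *P (oneP +P x)
  identity = solve-∀ ℤ[q]-solverRing

x*[c∷g]≈0⇒x≈0 : ∀ {c} g Z → c ≢ + 0 → Z *P (c ∷ g) ≈ [] → Z ≈ []
x*[c∷g]≈0⇒x≈0 g []      c≢0 _   = ≈-refl
x*[c∷g]≈0⇒x≈0 g (z ∷ Z) c≢0 Z*g≈0 with zc+0≡0 , rest≈0 ← ∷-≈[]⁻¹ Z*g≈0 =
  ∷-≈[] z≡0 (x*[c∷g]≈0⇒x≈0 g Z c≢0 Z*g≈0′)
  where
  z≡0 : z ≡ + 0
  z≡0 with ℤ.i*j≡0⇒i≡0∨j≡0 z (trans (sym (ℤ.+-identityʳ _)) zc+0≡0)
  ... | inj₁ z≡0 = z≡0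
  ... | inj₂ c≡0 = contradiction c≡0 c≢0
  Z*g≈0′ : Z *P (_ ∷ g) ≈ []
  Z*g≈0′ = ≈-trans (≈-sym (+-cong (≈-trans (scale-congʳ g z≡0) (scale-zero g)) ≈-refl)) rest≈0

*-cancelˡ-∷ : ∀ {c} g {A B} → c ≢ + 0 → (c ∷ g) *P A ≈ (c ∷ g) *P B → A ≈ B
*-cancelˡ-∷ {c} g {A} {B} c≢0 e = begin
  A                ≈⟨ split A B ⟩
  (A -P B) +P B    ≈⟨ +-cong (x*[c∷g]≈0⇒x≈0 g (A -P B) c≢0 A-B*c∷g≈0) (≈-refl {B}) ⟩
  [] +P B          ≡⟨⟩
  B                ∎
  where
  open ≈-Reasoning
  split : ∀ A B → A ≈ (A -P B) +P B
  split = solve-∀ ℤ[q]-solverRing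
  distrib : ∀ A B L → (A -P B) *P L ≈ L *P A -P L *P B
  distrib = solve-∀ ℤ[q]-solverRing
  A-B*c∷g≈0 : (A -P B) *P (c ∷ g) ≈ []
  A-B*c∷g≈0 = ≈-trans (distrib A B (c ∷ g)) (≈-trans (+-cong e ≈-refl) (-P-inverseʳ ((c ∷ g) *P B)))

1-q^suc-*-cancelˡ : ∀ k {A B} → 1-q^ (suc k) *P A ≈ 1-q^ (suc k) *P B → A ≈ B
1-q^suc-*-cancelˡ k = *-cancelˡ-∷ {+ 1} (map -_ (qPow k)) (λ ())

-- Evaluation and linear factors

eval : Poly → ℤ → ℤ
eval []      r = + 0
eval (a ∷ f) r = a +ℤ r *ℤ eval f r

eval-+ : ∀ f g r → eval (f +P g) r ≡ eval f r +ℤ eval g r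
eval-+ []      g       r = sym (ℤ.+-identityˡ (eval g r))
eval-+ (a ∷ f) []      r = sym (ℤ.+-identityʳ (eval (a ∷ f) r))
eval-+ (a ∷ f) (b ∷ g) r =
  trans (cong (λ t → (a +ℤ b) +ℤ r *ℤ t) (eval-+ f g r)) (regroup a b r (eval f r) (eval g r))
  where
  regroup : ∀ a b r u v → (a +ℤ b) +ℤ r *ℤ (u +ℤ v) ≡ (a +ℤ r *ℤ u) +ℤ (b +ℤ r *ℤ v)
  regroup = ℤ-Solver.solve-∀

eval-scale : ∀ a f r → eval (scaleP a f) r ≡ a *ℤ eval f r
eval-scale a []      r = sym (ℤ.*-zeroʳ a)
eval-scale a (b ∷ f) r =
  trans (cong (λ t → a *ℤ b +ℤ r *ℤ t) (eval-scale a f r)) (regroup a b r (eval f r))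
  where
  regroup : ∀ a b r u → a *ℤ b +ℤ r *ℤ (a *ℤ u) ≡ a *ℤ (b +ℤ r *ℤ u)
  regroup = ℤ-Solver.solve-∀

eval-* : ∀ f g r → eval (f *P g) r ≡ eval f r *ℤ eval g r
eval-* []      g r = refl
eval-* (a ∷ f) g r = begin
  eval (scaleP a g +P shift (f *P g)) r
    ≡⟨ eval-+ (scaleP a g) (shift (f *P g)) r ⟩
  eval (scaleP a g) r +ℤ (+ 0 +ℤ r *ℤ eval (f *P g) r)
    ≡⟨ cong₂ (λ u v → u +ℤ (+ 0 +ℤ r *ℤ v)) (eval-scale a g r) (eval-* f g r) ⟩
  a *ℤ eval g r +ℤ (+ 0 +ℤ r *ℤ (eval f r *ℤ eval g r))
    ≡⟨ regroup a r (eval f r) (eval g r) ⟩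
  (a +ℤ r *ℤ eval f r) *ℤ eval g r
    ∎
  where
  open ≡-Reasoning
  regroup : ∀ a r u v → a *ℤ v +ℤ (+ 0 +ℤ r *ℤ (u *ℤ v)) ≡ (a +ℤ r *ℤ u) *ℤ v
  regroup = ℤ-Solver.solve-∀

eval-≈[] : ∀ {f} r → f ≈ [] → eval f r ≡ + 0
eval-≈[] {[]}    r _      = refl
eval-≈[] {a ∷ f} r a∷f≈0 with a≡0 , f≈0 ← ∷-≈[]⁻¹ a∷f≈0 =
  trans (cong₂ (λ u v → u +ℤ r *ℤ v) a≡0 (eval-≈[] r f≈0)) (cong (+ 0 +ℤ_) (ℤ.*-zeroʳ r))

eval-cong : ∀ {f g} r → f ≈ g → eval f r ≡ eval g r
eval-cong {[]}    {g}     r f≈g = sym (eval-≈[] r (≈-sym f≈g))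
eval-cong {a ∷ f} {[]}    r f≈g = eval-≈[] r f≈g
eval-cong {a ∷ f} {b ∷ g} r f≈g with a≡b , f≈g′ ← ∷-injective f≈g =
  cong₂ (λ u v → u +ℤ r *ℤ v) a≡b (eval-cong r f≈g′)

q-_ : ℤ → Poly
q- r = - r ∷ + 1 ∷ []

q-r-* : ∀ r Q → q- r *P Q ≈ scaleP (- r) Q +P shift Q
q-r-* r Q = +-cong (≈-refl {scaleP (- r) Q}) (shift-cong (*-identityˡ Q))

eval-q-r : ∀ r → eval (q- r) r ≡ + 0
eval-q-r r = identity r
  where
  identity : ∀ r → - r +ℤ r *ℤ (+ 1 +ℤ r *ℤ + 0) ≡ + 0
  identity = ℤ-Solver.solve-∀

synthDiv : ℤ → Poly → Poly
synthDiv r []      = []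
synthDiv r (a ∷ C) = eval C r ∷ synthDiv r C

synthDiv-remainder : ∀ r C → C ≈ scaleP (- r) (synthDiv r C) +P (eval C r ∷ synthDiv r C)
synthDiv-remainder r []      = ≈-sym (∷-≈[] refl ≈-refl)
synthDiv-remainder r (a ∷ C) = ∷-cong (regroup a r (eval C r)) (synthDiv-remainder r C)
  where
  regroup : ∀ a r c → a ≡ - r *ℤ c +ℤ (a +ℤ r *ℤ c)
  regroup = ℤ-Solver.solve-∀

factor-theorem : ∀ r C → eval C r ≡ + 0 → C ≈ q- r *P synthDiv r C
factor-theorem r C C[r]≡0 = begin
  C                                          ≈⟨ synthDiv-remainder r C ⟩
  scaleP (- r) Q +P (eval C r ∷ Q)           ≈⟨ +-cong (≈-refl {scaleP (- r) Q}) (∷-cong C[r]≡0 ≈-refl) ⟩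
  scaleP (- r) Q +P shift Q                  ≈⟨ q-r-* r Q ⟨
  q- r *P Q                                  ∎
  where
  open ≈-Reasoning
  Q = synthDiv r C

-- r ≢ 0 because q - r is cancelled through its constant term - r.
∣-cancel-q-r : ∀ {h y} r → r ≢ + 0 → eval h r ≢ + 0 → h ∣ q- r *P y → h ∣ y
∣-cancel-q-r {h} {y} r r≢0 h[r]≢0 (C , C*h≈[q-r]*y) = Q , *-cancelˡ-∷ (+ 1 ∷ []) -r≢0 [q-r]*Q*h≈[q-r]*y
  where
  Q = synthDiv r C
  C[r]*h[r]≡0 : eval C r *ℤ eval h r ≡ + 0
  C[r]*h[r]≡0 = begin
    eval C r *ℤ eval h r         ≡⟨ eval-* C h r ⟨
    eval (C *P h) r              ≡⟨ eval-cong r C*h≈[q-r]*y ⟩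
    eval (q- r *P y) r           ≡⟨ eval-* (q- r) y r ⟩
    eval (q- r) r *ℤ eval y r    ≡⟨ cong (_*ℤ eval y r) (eval-q-r r) ⟩
    + 0 *ℤ eval y r              ≡⟨ ℤ.*-zeroˡ (eval y r) ⟩
    + 0                          ∎
    where open ≡-Reasoning
  C[r]≡0 : eval C r ≡ + 0
  C[r]≡0 with ℤ.i*j≡0⇒i≡0∨j≡0 (eval C r) C[r]*h[r]≡0
  ... | inj₁ C[r]≡0 = C[r]≡0
  ... | inj₂ h[r]≡0 = contradiction h[r]≡0 h[r]≢0
  -r≢0 : - r ≢ + 0
  -r≢0 -r≡0 = r≢0 (trans (sym (ℤ.neg-involutive r)) (cong -_ -r≡0))
  [q-r]*Q*h≈[q-r]*y : q- r *P (Q *P h) ≈ q- r *P y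
  [q-r]*Q*h≈[q-r]*y = ≈-trans (≈-sym (*-assoc (q- r) Q h))
                       (≈-trans (*-congʳ h (≈-sym (factor-theorem r C C[r]≡0))) C*h≈[q-r]*y)

-[1-q²]≈[q-1]*[q+1] : -P (1-q^ 2) ≈ q- (+ 1) *P q- (- + 1)
-[1-q²]≈[q-1]*[q+1] = coeffwise λ { 0 → refl ; 1 → refl ; 2 → refl ; (suc (suc (suc _))) → refl }

∣-cancel-1-q² : ∀ {h y} → eval h (+ 1) ≢ + 0 → eval h (- + 1) ≢ + 0 → h ∣ 1-q^ 2 *P y → h ∣ y
∣-cancel-1-q² {h} {y} h[1]≢0 h[-1]≢0 h∣[1-q²]*y =
  ∣-cancel-q-r (- + 1) (λ ()) h[-1]≢0
    (∣-cancel-q-r (+ 1) (λ ()) h[1]≢0 (∣ʳ-respʳ-≈ regroup (∣-neg h∣[1-q²]*y)))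
  where
  regroup : -P (1-q^ 2 *P y) ≈ q- (+ 1) *P (q- (- + 1) *P y)
  regroup = ≈-trans (negate (1-q^ 2) y)
                    (≈-trans (*-congʳ y -[1-q²]≈[q-1]*[q+1]) (*-assoc (q- (+ 1)) (q- (- + 1)) y))
    where
    negate : ∀ A y → -P (A *P y) ≈ (-P A) *P y
    negate = solve-∀ ℤ[q]-solverRing

-- Periods

-- q^e y ≡ y modulo h.
IsPeriod : Poly → Poly → ℕ → Set
IsPeriod h y e = h ∣ 1-q^ e *P y

module _ {h y : Poly} where

  isPeriod-0 : IsPeriod h y 0
  isPeriod-0 = ∣ʳ-respʳ-≈ (≈-sym (x≈0⇒x*y≈0 y 1-q^0≈0)) (h ∣0)

  isPeriod-+ : ∀ {a b} → IsPeriod h y a → IsPeriod h y b → IsPeriod h y (a + b)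
  isPeriod-+ {a} {b} pa pb = ∣ʳ-respʳ-≈ (≈-sym split) (∣-+ pa (x∣ʳy⇒x∣ʳzy (qPow a) pb))
    where
    split : 1-q^ (a + b) *P y ≈ 1-q^ a *P y +P qPow a *P (1-q^ b *P y)
    split = ≈-trans (*-congʳ y (1-q^-+ a b)) (distrib (1-q^ a) (qPow a) (1-q^ b) y)
      where
      distrib : ∀ A x B y → (A +P x *P B) *P y ≈ A *P y +P x *P (B *P y)
      distrib = solve-∀ ℤ[q]-solverRing

  isPeriod-∸ : ∀ {a b} → IsPeriod h y (a + b) → IsPeriod h y b → IsPeriod h y a
  isPeriod-∸ {a} {b} pab pb = ∣ʳ-respʳ-≈ (≈-sym split) (∣-- pab (x∣ʳy⇒x∣ʳzy (qPow a) pb))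
    where
    split : 1-q^ a *P y ≈ 1-q^ (a + b) *P y -P qPow a *P (1-q^ b *P y)
    split = ≈-trans (distrib (1-q^ a) (qPow a) (1-q^ b) y) (+-cong (*-congʳ y (≈-sym (1-q^-+ a b))) ≈-refl)
      where
      distrib : ∀ A x B y → A *P y ≈ (A +P x *P B) *P y -P x *P (B *P y)
      distrib = solve-∀ ℤ[q]-solverRing

  isPeriod-* : ∀ c {e} → IsPeriod h y e → IsPeriod h y (c * e)
  isPeriod-* zero    pe = isPeriod-0
  isPeriod-* (suc c) {e} pe = isPeriod-+ {e} {c * e} pe (isPeriod-* c {e} pe)

  isPeriod-bézout : ∀ {d m n} → Bézout.Identity d m n → IsPeriod h y m → IsPeriod h y n → IsPeriod h y d
  isPeriod-bézout {d} {m} {n} (Bézout.+- a b d+bn≡am) pm pn =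
    isPeriod-∸ {d} {b * n} (subst (IsPeriod h y) (sym d+bn≡am) (isPeriod-* a {m} pm)) (isPeriod-* b {n} pn)
  isPeriod-bézout {d} {m} {n} (Bézout.-+ a b d+am≡bn) pm pn =
    isPeriod-∸ {d} {a * m} (subst (IsPeriod h y) (sym d+am≡bn) (isPeriod-* b {n} pn)) (isPeriod-* a {m} pm)

bézout-equation-* : ∀ k d a b m n → d + b * n ≡ a * m → k * d + b * (k * n) ≡ a * (k * m)
bézout-equation-* k d a b m n eq =
  trans (distrib k d b n) (trans (cong (k *_) eq) (swap k a m))
  where
  distrib : ∀ k d b n → k * d + b * (k * n) ≡ k * (d + b * n)
  distrib = ℕ-Solver.solve-∀
  swap : ∀ k a m → k * (a * m) ≡ a * (k * m)
  swap = ℕ-Solver.solve-∀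

bézout-* : ∀ k {d m n} → Bézout.Identity d m n → Bézout.Identity (k * d) (k * m) (k * n)
bézout-* k {d} {m} {n} (Bézout.+- a b eq) = Bézout.+- a b (bézout-equation-* k d a b m n eq)
bézout-* k {d} {m} {n} (Bézout.-+ a b eq) = Bézout.-+ a b (bézout-equation-* k d b a n m eq)

-- q-binomial coefficients

module MonoidFold {a ℓ} (M : Monoid a ℓ) where
  private module M = Monoid M

  fold : List M.Carrier → M.Carrier
  fold = foldr M._∙_ M.ε

  fold-∷ʳ : ∀ xs x → fold (xs ∷ʳ x) M.≈ fold xs M.∙ x
  fold-∷ʳ []       x = M.trans (M.identityʳ x) (M.sym (M.identityˡ x))
  fold-∷ʳ (y ∷ xs) x = M.trans (M.∙-congˡ (fold-∷ʳ xs x)) (M.sym (M.assoc y (fold xs) x))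

  fold-map-upTo-sucʳ : ∀ (h : ℕ → M.Carrier) m →
                      fold (map h (upTo (suc m))) M.≈ fold (map h (upTo m)) M.∙ h m
  fold-map-upTo-sucʳ h m = M.trans (M.reflexive (cong fold upTo-snoc)) (fold-∷ʳ (map h (upTo m)) (h m))
    where
    upTo-snoc : map h (upTo (suc m)) ≡ map h (upTo m) ∷ʳ h m
    upTo-snoc = trans (cong (map h) (sym (LP.upTo-∷ʳ m))) (LP.map-++ h (upTo m) [ m ])

open MonoidFold (CommutativeRing.*-monoid ℤ[q]) using () renaming (fold-map-upTo-sucʳ to prodP-map-upTo-sucʳ)
open MonoidFold (CommutativeRing.+-monoid ℤ[q]) using () renaming (fold-map-upTo-sucʳ to sumP-map-upTo-sucʳ)

prodP-map-upTo-sucˡ : ∀ (h : ℕ → Poly) m → prodP (map h (upTo (suc m))) ≡ h 0 *P prodP (map (h ∘ suc) (upTo m))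
prodP-map-upTo-sucˡ h m =
  cong (λ fs → h 0 *P prodP fs) (trans (LP.map-applyUpTo suc h m) (sym (LP.map-upTo (h ∘ suc) m)))

qBinomDen-suc : ∀ m → qBinomDen (suc m) ≈ qBinomDen m *P 1-q^ (suc m)
qBinomDen-suc = prodP-map-upTo-sucʳ (λ i → 1-q^ (suc i))

qBinomNum-suc : ∀ n m → qBinomNum n (suc m) ≈ qBinomNum n m *P 1-q^ (n ∸ m)
qBinomNum-suc n = prodP-map-upTo-sucʳ (λ i → 1-q^ (n ∸ i))

qBinomNum-suc-suc : ∀ n m → qBinomNum (suc n) (suc m) ≡ 1-q^ (suc n) *P qBinomNum n m
qBinomNum-suc-suc n = prodP-map-upTo-sucˡ (λ i → 1-q^ (suc n ∸ i))

qBinom : ℕ → ℕ → Poly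
qBinom n       zero    = oneP
qBinom zero    (suc k) = []
qBinom (suc n) (suc k) = qBinom n k +P qPow (suc k) *P qBinom n (suc k)

qBinom-vanishes : ∀ {n k} → n < k → qBinom n k ≈ []
qBinom-vanishes {zero}  {suc k} _         = ≈-refl
qBinom-vanishes {suc n} {suc k} (s≤s n<k) = begin
  qBinom n k +P qPow (suc k) *P qBinom n (suc k)
    ≈⟨ +-cong (qBinom-vanishes n<k) (*-congˡ (qPow (suc k)) (qBinom-vanishes (NP.m<n⇒m<1+n n<k))) ⟩
  qPow (suc k) *P []
    ≈⟨ *-zeroʳ (qPow (suc k)) ⟩
  [] ∎
  where open ≈-Reasoning

qBinom-*-qBinomDen : ∀ {n m} → m ≤ n → qBinom n m *P qBinomDen m ≈ qBinomNum n m
qBinom-*-qBinomDen {n}     {zero}  _         = *-identityˡ oneP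
qBinom-*-qBinomDen {suc n} {suc m} (s≤s m≤n) = begin
  (A +P x *P B) *P qBinomDen (suc m)     ≈⟨ *-congˡ (A +P x *P B) (qBinomDen-suc m) ⟩
  (A +P x *P B) *P (D *P (oneP -P x))    ≈⟨ expand A B D x ⟩
  (A *P D) *P (oneP -P x) +P x *P (B *P (D *P (oneP -P x)))
    ≈⟨ +-cong (*-congʳ (oneP -P x) (qBinom-*-qBinomDen m≤n)) (*-congˡ x B*Den≈N*[1-y]) ⟩
  N *P (oneP -P x) +P x *P (N *P (oneP -P y)) ≈⟨ collect N x y ⟩
  (oneP -P x *P y) *P N                  ≈⟨ *-congʳ N (+-cong (≈-refl {oneP}) (-P-cong x*y≈q^[1+n])) ⟩
  1-q^ (suc n) *P N                      ≡⟨ qBinomNum-suc-suc n m ⟨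
  qBinomNum (suc n) (suc m)              ∎
  where
  open ≈-Reasoning
  A = qBinom n m
  B = qBinom n (suc m)
  D = qBinomDen m
  N = qBinomNum n m
  x = qPow (suc m)
  y = qPow (n ∸ m)
  expand : ∀ A B D x → (A +P x *P B) *P (D *P (oneP -P x))
                       ≈ (A *P D) *P (oneP -P x) +P x *P (B *P (D *P (oneP -P x)))
  expand = solve-∀ ℤ[q]-solverRing
  collect : ∀ N x y → N *P (oneP -P x) +P x *P (N *P (oneP -P y)) ≈ (oneP -P x *P y) *P N
  collect = solve-∀ ℤ[q]-solverRing
  x*y≈q^[1+n] : x *P y ≈ qPow (suc n)
  x*y≈q^[1+n] = ≈-trans (≈-sym (qPow-+ (suc m) (n ∸ m)))
                        (≈-reflexive (cong (qPow ∘ suc) (NP.m+[n∸m]≡n m≤n)))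
  B*Den≈N*[1-y] : B *P (D *P (oneP -P x)) ≈ N *P (oneP -P y)
  B*Den≈N*[1-y] with NP.m≤n⇒m<n∨m≡n m≤n
  ... | inj₁ m<n = ≈-trans (*-congˡ B (≈-sym (qBinomDen-suc m)))
                  (≈-trans (qBinom-*-qBinomDen m<n) (qBinomNum-suc n m))
  ... | inj₂ refl = begin
    B *P (D *P (oneP -P x)) ≈⟨ x≈0⇒x*y≈0 _ (qBinom-vanishes (NP.n<1+n n)) ⟩
    []                      ≈⟨ x≈0⇒x*y≈0 N 1-q^0≈0 ⟨
    1-q^ 0 *P N             ≈⟨ *-comm (1-q^ 0) N ⟩
    N *P 1-q^ 0             ≡⟨ cong (λ k → N *P 1-q^ k) (NP.n∸n≡0 n) ⟨
    N *P (oneP -P y)        ∎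

-- Congruences modulo [p]_{q²}

qInt-q²-suc : ∀ n → qInt-q² (suc n) ≈ qInt-q² n +P qPow (2 * n)
qInt-q²-suc = sumP-map-upTo-sucʳ (λ j → qPow (2 * j))

1-q²-*-qInt-q² : ∀ n → 1-q^ 2 *P qInt-q² n ≈ 1-q^ (2 * n)
1-q²-*-qInt-q² zero    = ≈-trans (*-zeroʳ (1-q^ 2)) (≈-sym 1-q^0≈0)
1-q²-*-qInt-q² (suc n) = begin
  1-q^ 2 *P qInt-q² (suc n)                  ≈⟨ *-congˡ (1-q^ 2) (qInt-q²-suc n) ⟩
  1-q^ 2 *P (qInt-q² n +P qPow (2 * n))      ≈⟨ *-distribˡ (1-q^ 2) (qInt-q² n) (qPow (2 * n)) ⟩
  1-q^ 2 *P qInt-q² n +P 1-q^ 2 *P qPow (2 * n)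
    ≈⟨ +-cong (1-q²-*-qInt-q² n) (*-comm (1-q^ 2) (qPow (2 * n))) ⟩
  1-q^ (2 * n) +P qPow (2 * n) *P 1-q^ 2     ≈⟨ 1-q^-+ (2 * n) 2 ⟨
  1-q^ (2 * n + 2)                           ≡⟨ cong 1-q^_ (trans (NP.+-comm (2 * n) 2) (sym (NP.*-suc 2 n))) ⟩
  1-q^ (2 * suc n)                           ∎
  where open ≈-Reasoning

eval-qPow-2* : ∀ {r} → r *ℤ r ≡ + 1 → ∀ j → eval (qPow (2 * j)) r ≡ + 1
eval-qPow-2* {r} r²≡1 zero    = cong (+ 1 +ℤ_) (ℤ.*-zeroʳ r)
eval-qPow-2* {r} r²≡1 (suc j) = begin
  eval (qPow (2 * suc j)) r
    ≡⟨ cong (λ k → eval (qPow k) r) (NP.*-suc 2 j) ⟩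
  + 0 +ℤ r *ℤ (+ 0 +ℤ r *ℤ eval (qPow (2 * j)) r)
    ≡⟨ cong (λ t → + 0 +ℤ r *ℤ (+ 0 +ℤ r *ℤ t)) (eval-qPow-2* r²≡1 j) ⟩
  + 0 +ℤ r *ℤ (+ 0 +ℤ r *ℤ + 1)
    ≡⟨ simplify r ⟩
  r *ℤ r
    ≡⟨ r²≡1 ⟩
  + 1
    ∎
  where
  open ≡-Reasoning
  simplify : ∀ r → + 0 +ℤ r *ℤ (+ 0 +ℤ r *ℤ + 1) ≡ r *ℤ r
  simplify = ℤ-Solver.solve-∀

eval-qInt-q² : ∀ {r} → r *ℤ r ≡ + 1 → ∀ n → eval (qInt-q² n) r ≡ + n
eval-qInt-q² {r} r²≡1 n = trans (eval-sum (upTo n)) (cong +_ (LP.length-upTo n))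
  where
  eval-sum : ∀ js → eval (sumP (map (λ j → qPow (2 * j)) js)) r ≡ + length js
  eval-sum []       = refl
  eval-sum (j ∷ js) = trans (eval-+ (qPow (2 * j)) _ r) (cong₂ _+ℤ_ (eval-qPow-2* r²≡1 j) (eval-sum js))

qInt-q²-∣-cancel-1-q² : ∀ n {y} → qInt-q² (suc n) ∣ 1-q^ 2 *P y → qInt-q² (suc n) ∣ y
qInt-q²-∣-cancel-1-q² n = ∣-cancel-1-q² (nonzero refl) (nonzero refl)
  where
  nonzero : ∀ {r} → r *ℤ r ≡ + 1 → eval (qInt-q² (suc n)) r ≢ + 0
  nonzero r²≡1 f[r]≡0 with () ← trans (sym (eval-qInt-q² r²≡1 (suc n))) f[r]≡0

qInt-q²-∣-1-q^2* : ∀ n → qInt-q² n ∣ 1-q^ (2 * n)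
qInt-q²-∣-1-q^2* n = 1-q^ 2 , 1-q²-*-qInt-q² n

-- j and 2p are periods of y, hence so is gcd(2j, 2p) = 2; then 1 - q² = -(q - 1)(q + 1)
-- cancels because [p]_{q²} takes the value p at q = ±1.
qInt-q²-∣-cancel-1-q^ : ∀ {p j y} → Prime p → 0 < j → j < p → qInt-q² p ∣ 1-q^ j *P y → qInt-q² p ∣ y
qInt-q²-∣-cancel-1-q^ {suc s} {suc i} {y} p-prime _ j<p period-j =
  qInt-q²-∣-cancel-1-q² s (isPeriod-bézout bézout-2 period-2p (isPeriod-* 2 {suc i} period-j))
  where
  p = suc s
  bézout-2 : Bézout.Identity 2 (2 * p) (2 * suc i)
  bézout-2 = bézout-* 2 (coprime-Bézout (prime⇒coprime p-prime j<p))
  period-2p : IsPeriod (qInt-q² p) y (2 * p)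
  period-2p = ∣-*ʳ y (qInt-q²-∣-1-q^2* p)

qInt-q²-∣-cancel-qBinomDen : ∀ {p y} m → Prime p → m < p → qInt-q² p ∣ y *P qBinomDen m → qInt-q² p ∣ y
qInt-q²-∣-cancel-qBinomDen {y = y} zero    _       _    h∣y*1 = ∣ʳ-respʳ-≈ (*-identityʳ y) h∣y*1
qInt-q²-∣-cancel-qBinomDen {y = y} (suc m) p-prime 1+m<p h∣y*D =
  qInt-q²-∣-cancel-qBinomDen m p-prime (NP.<⇒≤ 1+m<p)
    (qInt-q²-∣-cancel-1-q^ p-prime (s≤s z≤n) 1+m<p (∣ʳ-respʳ-≈ regroup h∣y*D))
  where
  regroup : y *P qBinomDen (suc m) ≈ 1-q^ (suc m) *P (y *P qBinomDen m)
  regroup = ≈-trans (*-congˡ y (qBinomDen-suc m)) (rotate y (qBinomDen m) (1-q^ (suc m)))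
    where
    rotate : ∀ y D A → y *P (D *P A) ≈ A *P (y *P D)
    rotate = solve-∀ ℤ[q]-solverRing

qInt-q²-∣-qBinom-2p : ∀ {p k} → Prime p → 0 < k → k < p → qInt-q² p ∣ qBinom (2 * p) k
qInt-q²-∣-qBinom-2p {p@(suc s)} {suc i} p-prime _ k<p =
  qInt-q²-∣-cancel-qBinomDen (suc i) p-prime k<p (∣ʳ-respʳ-≈ (≈-sym G*D≈N) h∣N)
  where
  G*D≈N : qBinom (2 * p) (suc i) *P qBinomDen (suc i) ≈ qBinomNum (2 * p) (suc i)
  G*D≈N = qBinom-*-qBinomDen (NP.≤-trans (NP.<⇒≤ k<p) (NP.m≤m+n p (p + 0)))
  h∣N : qInt-q² p ∣ qBinomNum (2 * p) (suc i)
  h∣N = ∣ʳ-respʳ-≈ (≈-reflexive (sym (qBinomNum-suc-suc _ i))) (∣-*ʳ _ (qInt-q²-∣-1-q^2* p))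

-- Modulo h, (1 + q^n) q^n ≡ 1 + q^n, so after multiplying by 1 + q^n each factor
-- 1 - q^(n+i) of the numerator may be replaced by 1 - q^i.
qBinomNum-shifted-≡-qBinomDen : ∀ {h} n m → h ∣ 1-q^ (2 * n) →
                          h ∣ (oneP +P qPow n) *P (qBinomNum (n + m) m -P qBinomDen m)
qBinomNum-shifted-≡-qBinomDen n zero    _ = ∣ʳ-respʳ-≈ (≈-sym (vanish (qPow n))) (_ ∣0)
  where
  vanish : ∀ x → (oneP +P x) *P (oneP -P oneP) ≈ []
  vanish = solve-∀ ℤ[q]-solverRing
qBinomNum-shifted-≡-qBinomDen {h} n (suc m) h∣1-q^2n =
  ∣ʳ-respʳ-≈ (≈-sym split)
    (∣-+ (x∣ʳy⇒x∣ʳzy (oneP -P y) (qBinomNum-shifted-≡-qBinomDen n m h∣1-q^2n))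
         (x∣ʳy⇒x∣ʳzy (y *P N) (∣ʳ-respʳ-≈ (1-q^-2*-square n) h∣1-q^2n)))
  where
  open ≈-Reasoning
  x = qPow n
  y = qPow (suc m)
  N = qBinomNum (n + m) m
  D = qBinomDen m
  numerator : qBinomNum (n + suc m) (suc m) ≈ (oneP -P x *P y) *P N
  numerator = begin
    qBinomNum (n + suc m) (suc m)  ≡⟨ cong (λ k → qBinomNum k (suc m)) (NP.+-suc n m) ⟩
    qBinomNum (suc (n + m)) (suc m) ≡⟨ qBinomNum-suc-suc (n + m) m ⟩
    1-q^ (suc (n + m)) *P N        ≡⟨ cong (λ k → 1-q^ k *P N) (NP.+-suc n m) ⟨
    1-q^ (n + suc m) *P N          ≈⟨ *-congʳ N (+-cong (≈-refl {oneP}) (-P-cong (qPow-+ n (suc m)))) ⟩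
    (oneP -P x *P y) *P N          ∎
  regroup : ∀ x y N D → (oneP +P x) *P ((oneP -P x *P y) *P N -P D *P (oneP -P y))
                        ≈ (oneP -P y) *P ((oneP +P x) *P (N -P D)) +P (y *P N) *P (oneP -P x *P x)
  regroup = solve-∀ ℤ[q]-solverRing
  split : (oneP +P x) *P (qBinomNum (n + suc m) (suc m) -P qBinomDen (suc m))
          ≈ (oneP -P y) *P ((oneP +P x) *P (N -P D)) +P (y *P N) *P (oneP -P x *P x)
  split = ≈-trans (*-congˡ (oneP +P x) (+-cong numerator (-P-cong (qBinomDen-suc m)))) (regroup x y N D)

qInt-q²-∣-qBinom-2p-p : ∀ {p} → Prime p → qInt-q² p ∣ qBinom (2 * p) p -P (oneP +P qPow p)
qInt-q²-∣-qBinom-2p-p {p@(suc s)} p-prime =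
  qInt-q²-∣-cancel-qBinomDen s p-prime (NP.n<1+n s)
    (∣ʳ-respʳ-≈ (≈-sym factor) (qBinomNum-shifted-≡-qBinomDen p s (qInt-q²-∣-1-q^2* p)))
  where
  open ≈-Reasoning
  x = qPow p
  G = qBinom (2 * p) p
  N = qBinomNum (p + s) s
  D = qBinomDen s
  2p-1≡p+s : s + suc (s + 0) ≡ p + s
  2p-1≡p+s = trans (NP.+-suc s (s + 0)) (cong (λ t → suc (s + t)) (NP.+-identityʳ s))
  G*D≈[1+x]*N : G *P D ≈ (oneP +P x) *P N
  G*D≈[1+x]*N = 1-q^suc-*-cancelˡ s (begin
    1-q^ p *P (G *P D)                             ≈⟨ rotate (1-q^ p) G D ⟩
    G *P (D *P 1-q^ p)                             ≈⟨ *-congˡ G (qBinomDen-suc s) ⟨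
    G *P qBinomDen p                               ≈⟨ qBinom-*-qBinomDen (NP.m≤m+n p (p + 0)) ⟩
    qBinomNum (2 * p) p                            ≡⟨ qBinomNum-suc-suc (s + suc (s + 0)) s ⟩
    1-q^ (2 * p) *P qBinomNum (s + suc (s + 0)) s  ≡⟨ cong (λ k → 1-q^ (2 * p) *P qBinomNum k s) 2p-1≡p+s ⟩
    1-q^ (2 * p) *P N                              ≈⟨ *-congʳ N (1-q^-2* p) ⟩
    (1-q^ p *P (oneP +P x)) *P N                   ≈⟨ *-assoc (1-q^ p) (oneP +P x) N ⟩
    1-q^ p *P ((oneP +P x) *P N)                   ∎)
    where
    rotate : ∀ A G D → A *P (G *P D) ≈ G *P (D *P A)
    rotate = solve-∀ ℤ[q]-solverRing
  factor : (G -P (oneP +P x)) *P D ≈ (oneP +P x) *P (N -P D)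
  factor = begin
    (G -P (oneP +P x)) *P D               ≈⟨ distribʳ G (oneP +P x) D ⟩
    G *P D -P (oneP +P x) *P D            ≈⟨ +-cong G*D≈[1+x]*N ≈-refl ⟩
    (oneP +P x) *P N -P (oneP +P x) *P D  ≈⟨ distribˡ (oneP +P x) N D ⟨
    (oneP +P x) *P (N -P D)               ∎
    where
    distribʳ : ∀ A B C → (A -P B) *P C ≈ A *P C -P B *P C
    distribʳ = solve-∀ ℤ[q]-solverRing
    distribˡ : ∀ A B C → A *P (B -P C) ≈ A *P B -P A *P C
    distribˡ = solve-∀ ℤ[q]-solverRing

qInt-q²-∣-qBinom-2p+2-p : ∀ {p} → Prime p → 2 < p → qInt-q² p ∣ qBinom (2 * p + 2) p -P (oneP +P qPow p)
qInt-q²-∣-qBinom-2p+2-p {p@(suc (suc (suc r)))} p-prime (s≤s (s≤s (s≤s _))) =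
  subst (λ n → qInt-q² p ∣ qBinom n p -P (oneP +P x)) (NP.+-comm 2 (2 * p))
    (∣ʳ-respʳ-≈ (≈-sym (pascal² A B C x y))
      (∣-- (∣-+ (∣-+ f∣A (x∣ʳy⇒x∣ʳzy (y +P x) f∣B)) (x∣ʳy⇒x∣ʳzy (x *P x) f∣C-[1+x]))
           (x∣ʳy⇒x∣ʳzy (oneP +P x) f∣1-x²)))
  where
  x = qPow p
  y = qPow (suc (suc r))
  A = qBinom (2 * p) (suc r)
  B = qBinom (2 * p) (suc (suc r))
  C = qBinom (2 * p) p
  -- At A B C x y the left-hand side is qBinom (2 + 2 * p) p -P (oneP +P x), by Pascal's rule twice.
  pascal² : ∀ A B C x y → (A +P y *P B) +P x *P (B +P x *P C) -P (oneP +P x)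
            ≈ A +P (y +P x) *P B +P (x *P x) *P (C -P (oneP +P x)) -P (oneP +P x) *P (oneP -P x *P x)
  pascal² = solve-∀ ℤ[q]-solverRing
  f∣A : qInt-q² p ∣ A
  f∣A = qInt-q²-∣-qBinom-2p p-prime (s≤s z≤n) (NP.m<n⇒m<1+n (NP.n<1+n (suc r)))
  f∣B : qInt-q² p ∣ B
  f∣B = qInt-q²-∣-qBinom-2p p-prime (s≤s z≤n) (NP.n<1+n (suc (suc r)))
  f∣C-[1+x] : qInt-q² p ∣ C -P (oneP +P x)
  f∣C-[1+x] = qInt-q²-∣-qBinom-2p-p p-prime
  f∣1-x² : qInt-q² p ∣ oneP -P x *P x
  f∣1-x² = ∣ʳ-respʳ-≈ (1-q^-2*-square p) (qInt-q²-∣-1-q^2* p)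

lemma3p2 : (p : ℕ) → Prime p → p ≢ 2 →
    ∃ λ B → IsQBinom (2 * p + 2) p B × (B ≡P oneP +P qPow p [mod qInt-q² p ])
lemma3p2 p p-prime p≢2 =
  qBinom (2 * p + 2) p ,
  coeff-≡ (qBinom-*-qBinomDen p≤2p+2) ,
  ∣⇒∣P (qInt-q²-∣-qBinom-2p+2-p p-prime 2<p)
  where
  p≤2p+2 : p ≤ 2 * p + 2
  p≤2p+2 = NP.≤-trans (NP.m≤m+n p (p + 0)) (NP.m≤m+n (2 * p) 2)
  2<p : 2 < p
  2<p = NP.≤∧≢⇒< (nonTrivial⇒n>1 p {{prime⇒nonTrivial p-prime}}) (≢-sym p≢2)
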